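{- Any linear operator $\bigstar$ on $\mathcal{Q}$ which acts on $(p_1, \ldots, p_k) \in \overline{\mathbb{Z}}^*$ by \[\bigstar (p_1, \ldots, p_k) = f(\mathrm{val}(p_1)) \cdot (p_2, \ldots, p_k),\] where $f$ is some function $\mathbb{Z} \rightarrow \mathbb{Q}$, satisfies the Leibniz rule up to maximal bottom row equivalence, i.e. $\bigstar (\boldsymbol{p} \boldsymbol{q}) \equiv \bigstar(\boldsymbol{p})\boldsymbol{q} + \boldsymbol{p}\bigstar(\boldsymbol{q})$.
   Context: Colored words are finite words over $\overline{\mathbb{Z}}=\{i^{[j]} : i\in\mathbb{Z}, j\in\mathbb{Z}_+\}$ (value $i=\mathrm{val}(i^{[j]})$, color $j$), ordered by value then color. The product $\boldsymbol{p}\boldsymbol{q}$ is the colored shuffle product $\boldsymbol{p} \sqcup\!\sqcup (\boldsymbol{q}\uparrow \operatorname{maxcol}(\boldsymbol{p}))$, where $\sqcup\!\sqcup$ is the Eilenberg–Mac Lane shuffle product (sum of all order-preserving interlacings of the two words), $\operatorname{maxcol}$ is the maximal color and $\uparrow a$ adds $a$ to every color; $\mathcal{Q}=\mathbb{Q}[\overline{\mathbb{Z}}^*]$. Words $\boldsymbol{p}\equiv\boldsymbol{q}$ iff $m(\boldsymbol{p})=m(\boldsymbol{q})$, where $m(\boldsymbol{t})_k=\mathrm{val}(t_k)$ and, for $j<k$, $m(\boldsymbol{t})_j=m(\boldsymbol{t})_{j+1}$ if $t_j\ge t_{j+1}$, else $\min(\mathrm{val}(t_j),m(\boldsymbol{t})_{j+1}-1)$;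 extended linearly. -}

module Defs where

open import Data.Nat as ℕ using (ℕ; zero; suc; _≤_)
open import Data.Nat.Properties as ℕP using (≤-trans; m≤m+n)
open import Data.Integer as ℤ using (ℤ; _⊓_) renaming (_-_ to _-ℤ_)
import Data.Integer.Properties as ℤP
open import Data.Rational as ℚ using (ℚ) renaming (_+_ to _+ℚ_; _*_ to _*ℚ_; 0ℚ to 0ℚ; 1ℚ to 1ℚ)
open import Data.List using (List; []; _∷_; _++_; map; concatMap; foldr)
open import Data.List.Properties using (≡-dec)
open import Data.Product using (_×_; _,_)
open import Data.Bool using (Bool; true; false; if_then_else_; _∧_; _∨_)
open import Relation.Nullary using (does)
open import Relation.Binary.PropositionalEquality using (_≡_)

record Letter : Set where
  constructor _^[_]⟨_⟩
  field
    val    : ℤ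
    col    : ℕ
    colPos : 1 ≤ col
open Letter public

Word : Set
Word = List Letter

_≤ᶜ_ : Letter → Letter → Bool
x ≤ᶜ y = does (val x ℤ.<? val y)
         ∨ (does (val x ℤ.≟ val y) ∧ does (col x ℕ.≤? col y))

maxcol : Word → ℕ
maxcol []      = 0
maxcol (x ∷ w) = col x ℕ.⊔ maxcol w

shiftL : ℕ → Letter → Letter
shiftL a (i ^[ j ]⟨ p ⟩) = i ^[ j ℕ.+ a ]⟨ ≤-trans p (m≤m+n j a) ⟩

_↑_ : Word → ℕ → Word
w ↑ a = map (shiftL a) w

shuffle : {A : Set} → List A → List A → List (List A)
shuffle []      v       = v ∷ []
shuffle (x ∷ u) []      = (x ∷ u) ∷ []
shuffle (x ∷ u) (y ∷ v) = map (x ∷_) (shuffle u (y ∷ v)) ++ map (y ∷_) (shuffle (x ∷ u) v)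

-- Formal ℚ-linear combinations (elements of 𝒬 = ℚ[ℤ̄*]) as finite lists of terms

Lin : Set → Set
Lin A = List (ℚ × A)

⟦_⟧ : {A : Set} → A → Lin A
⟦ w ⟧ = (1ℚ , w) ∷ []

_⊕_ : {A : Set} → Lin A → Lin A → Lin A
_⊕_ = _++_

linExt : {A B : Set} → (A → Lin B) → Lin A → Lin B
linExt g = concatMap (λ { (c , a) → map (λ { (d , b) → (c *ℚ d , b) }) (g a) })

bilinExt : {A B C : Set} → (A → B → Lin C) → Lin A → Lin B → Lin C
bilinExt g P Q = linExt (λ a → linExt (g a) Q) P

Q : Set
Q = Lin Word

wordProd : Word → Word → Q
wordProd p q = map (λ w → (1ℚ , w)) (shuffle p (q ↑ maxcol p))

_·_ : Q → Q → Q
_·_ = bilinExt wordProd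

mHead : Letter → Word → ℤ
mHead x []      = val x
mHead x (y ∷ w) = if y ≤ᶜ x
                  then mHead y w
                  else val x ⊓ (mHead y w -ℤ ℤ.+ 1)

m : Word → List ℤ
m []      = []
m (x ∷ w) = mHead x w ∷ m w

coeff : Lin (List ℤ) → List ℤ → ℚ
coeff P u = foldr (λ { (c , v) r → (if does (≡-dec ℤ._≟_ v u) then c else 0ℚ) +ℚ r }) 0ℚ P

mLin : Q → Lin (List ℤ)
mLin = linExt (λ t → ⟦ m t ⟧)

_≡ₘ_ : Q → Q → Set
P ≡ₘ R = ∀ u → coeff (mLin P) u ≡ coeff (mLin R) u

starWord : (ℤ → ℚ) → Word → Q
starWord f []      = []
starWord f (x ∷ w) = (f (val x) , w) ∷ []

star : (ℤ → ℚ) → Q → Q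
star f = linExt (starWord f)

{-# OPTIONS --safe #-}
module Submission where

-- For p = x ∷ p' and q = y ∷ q', the first letter of an interlacing of p with q ↑ maxcol p is x or y,
-- so ★(pq) = f(x)·(p' ⧢ q ↑ maxcol p) + f(y)·(p ⧢ q' ↑ maxcol p). The second summand is p★(q); the first
-- differs from ★(p)q = f(x)·(p' ⧢ q ↑ maxcol p') only by the size of the shift. Both shifts lift every
-- color of q above all colors of p', so any comparison of a letter of p' with one of q is decided by
-- values alone; since m sees only values and comparisons of adjacent letters, it identifies the two.

open import Defs
open import Data.Integer using (ℤ)
open import Data.Rational using (ℚ; 1ℚ) renaming (_*_ to _*ℚ_)

open import Data.Nat using (ℕ; _≤_; _<_; _+_; _≤?_; s≤s)
open import Data.Nat.Properties
  using (≤-refl; ≤-trans; <⇒≤; <⇒≱; +-cancelʳ-≤; +-monoˡ-≤; m≤m⊔n; m≤n⊔m)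
open import Data.Rational.Properties using (*-identityˡ; *-identityʳ)
open import Data.List using (List; []; _∷_; _++_; map)
open import Data.List.Properties using (map-∘; map-id; map-++; map-cong-local; concatMap-++; ++-identityʳ)
open import Data.List.Relation.Unary.All as All using (All; []; _∷_)
open import Data.List.Relation.Unary.All.Properties using (map⁺; ++⁺)
open import Data.Product using (_×_; _,_)
open import Data.Sum using (_⊎_; inj₁; inj₂; [_,_]′)
open import Data.Unit using (⊤; tt)
open import Function using (id; _∘_; mk⇔)
open import Relation.Nullary using (does)
open import Relation.Nullary.Decidable using (dec-true; dec-false; does-⇔)
open import Relation.Binary.PropositionalEquality
open ≡-Reasoning

≤ᶜ-cong : ∀ {x x' y y'} → val x ≡ val x' → val y ≡ val y' →
          does (col x ≤? col y) ≡ does (col x' ≤? col y') → (x ≤ᶜ y) ≡ (x' ≤ᶜ y')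
≤ᶜ-cong ex ey ec rewrite ex | ey | ec = refl

col<col-shiftL : ∀ {a} x y → col x ≤ a → col x < col (shiftL a y)
col<col-shiftL {a} x y x≤a = ≤-trans (s≤s x≤a) (+-monoˡ-≤ a (colPos y))

does-+-≤?-+ : ∀ a m n → does (m + a ≤? n + a) ≡ does (m ≤? n)
does-+-≤?-+ a m n = does-⇔ (mk⇔ (+-cancelʳ-≤ a m n) (+-monoˡ-≤ a)) (m + a ≤? n + a) (m ≤? n)

col≤maxcol : ∀ w → All (λ x → col x ≤ maxcol w) w
col≤maxcol []      = []
col≤maxcol (x ∷ w) = m≤m⊔n (col x) (maxcol w)
                   ∷ All.map (λ h → ≤-trans h (m≤n⊔m (col x) (maxcol w))) (col≤maxcol w)

module _ {A : Set} {P : A → Set} (φ ψ : A → Letter)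
         (val-agree : ∀ {z} → P z → val (φ z) ≡ val (ψ z))
         (≤ᶜ-agree : ∀ {y z} → P y → P z → (φ y ≤ᶜ φ z) ≡ (ψ y ≤ᶜ ψ z)) where

  mHead-map-cong : ∀ {z w} → P z → All P w → mHead (φ z) (map φ w) ≡ mHead (ψ z) (map ψ w)
  mHead-map-cong pz []        = val-agree pz
  mHead-map-cong pz (py ∷ pw)
    rewrite ≤ᶜ-agree py pz | val-agree pz | mHead-map-cong py pw = refl

  m-map-cong : ∀ {w} → All P w → m (map φ w) ≡ m (map ψ w)
  m-map-cong []        = refl
  m-map-cong (pz ∷ pw) = cong₂ _∷_ (mHead-map-cong pz pw) (m-map-cong pw)

shuffle-identityʳ : ∀ {A : Set} (u : List A) → shuffle u [] ≡ u ∷ []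
shuffle-identityʳ []      = refl
shuffle-identityʳ (x ∷ u) = refl

shuffle⁺ : ∀ {A : Set} {P : A → Set} {u v} → All P u → All P v → All (All P) (shuffle u v)
shuffle⁺ []        pv        = pv ∷ []
shuffle⁺ (px ∷ pu) []        = (px ∷ pu) ∷ []
shuffle⁺ (px ∷ pu) (py ∷ pv) =
  ++⁺ (map⁺ (All.map (px ∷_) (shuffle⁺ pu (py ∷ pv))))
      (map⁺ (All.map (py ∷_) (shuffle⁺ (px ∷ pu) pv)))

shuffle-map : ∀ {A B : Set} (φ : A → B) u v →
              shuffle (map φ u) (map φ v) ≡ map (map φ) (shuffle u v)
shuffle-map φ []      v       = refl
shuffle-map φ (x ∷ u) []      = refl
shuffle-map φ (x ∷ u) (y ∷ v) = begin
  map (φ x ∷_) (shuffle (map φ u) (map φ (y ∷ v)))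
    ++ map (φ y ∷_) (shuffle (map φ (x ∷ u)) (map φ v))
    ≡⟨ cong₂ _++_ (cong (map (φ x ∷_)) (shuffle-map φ u (y ∷ v)))
                  (cong (map (φ y ∷_)) (shuffle-map φ (x ∷ u) v)) ⟩
  map (φ x ∷_) (map (map φ) S₁) ++ map (φ y ∷_) (map (map φ) S₂)
    ≡⟨ cong₂ _++_ (map-cons-commute x S₁) (map-cons-commute y S₂) ⟩
  map (map φ) (map (x ∷_) S₁) ++ map (map φ) (map (y ∷_) S₂)
    ≡⟨ map-++ (map φ) (map (x ∷_) S₁) (map (y ∷_) S₂) ⟨
  map (map φ) (map (x ∷_) S₁ ++ map (y ∷_) S₂)
    ∎
  where
  S₁ = shuffle u (y ∷ v)
  S₂ = shuffle (x ∷ u) v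
  map-cons-commute : ∀ z S → map (φ z ∷_) (map (map φ) S) ≡ map (map φ) (map (z ∷_) S)
  map-cons-commute z S = trans (sym (map-∘ S)) (map-∘ S)

-- Tagging each letter with its factor turns the interlacings with v ↑ a and with v ↑ b into
-- the images of the same tagged words under two letter maps, to which m-map-cong applies.
untag : ℕ → Letter ⊎ Letter → Letter
untag a = [ id , shiftL a ]′

shuffle-↑-untag : ∀ a u v →
  shuffle u (v ↑ a) ≡ map (map (untag a)) (shuffle (map inj₁ u) (map inj₂ v))
shuffle-↑-untag a u v = begin
  shuffle u (v ↑ a)
    ≡⟨ cong₂ shuffle (trans (sym (map-id u)) (map-∘ u)) (map-∘ v) ⟩
  shuffle (map (untag a) (map inj₁ u)) (map (untag a) (map inj₂ v))
    ≡⟨ shuffle-map (untag a) (map inj₁ u) (map inj₂ v) ⟩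
  map (map (untag a)) (shuffle (map inj₁ u) (map inj₂ v))
    ∎

m-shuffle-↑ : ∀ {a b} u v → maxcol u ≤ a → maxcol u ≤ b →
              map m (shuffle u (v ↑ a)) ≡ map m (shuffle u (v ↑ b))
m-shuffle-↑ {a} {b} u v u≤a u≤b = begin
  map m (shuffle u (v ↑ a))
    ≡⟨ cong (map m) (shuffle-↑-untag a u v) ⟩
  map m (map (map (untag a)) W)
    ≡⟨ map-∘ W ⟨
  map (m ∘ map (untag a)) W
    ≡⟨ map-cong-local (All.map (m-map-cong (untag a) (untag b) val-agree ≤ᶜ-agree) allBelow) ⟩
  map (m ∘ map (untag b)) W
    ≡⟨ map-∘ W ⟩
  map m (map (map (untag b)) W)
    ≡⟨ cong (map m) (shuffle-↑-untag b u v) ⟨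
  map m (shuffle u (v ↑ b))
    ∎
  where
  W = shuffle (map inj₁ u) (map inj₂ v)

  Below : Letter ⊎ Letter → Set
  Below (inj₁ x) = col x ≤ a × col x ≤ b
  Below (inj₂ _) = ⊤

  allBelow : All (All Below) W
  allBelow = shuffle⁺ (map⁺ (All.map (λ h → ≤-trans h u≤a , ≤-trans h u≤b) (col≤maxcol u)))
                      (map⁺ (All.universal (λ _ → tt) v))

  val-agree : ∀ {s} → Below s → val (untag a s) ≡ val (untag b s)
  val-agree {inj₁ _} _ = refl
  val-agree {inj₂ _} _ = refl

  col-agree : ∀ {s t} → Below s → Below t →
    does (col (untag a s) ≤? col (untag a t)) ≡ does (col (untag b s) ≤? col (untag b t))
  col-agree {inj₁ _} {inj₁ _} _ _ = refl
  col-agree {inj₁ x} {inj₂ y} (x≤a , x≤b) _ =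
    trans (dec-true (col x ≤? col y + a) (<⇒≤ (col<col-shiftL x y x≤a)))
          (sym (dec-true (col x ≤? col y + b) (<⇒≤ (col<col-shiftL x y x≤b))))
  col-agree {inj₂ y} {inj₁ x} _ (x≤a , x≤b) =
    trans (dec-false (col y + a ≤? col x) (<⇒≱ (col<col-shiftL x y x≤a)))
          (sym (dec-false (col y + b ≤? col x) (<⇒≱ (col<col-shiftL x y x≤b))))
  col-agree {inj₂ y} {inj₂ z} _ _ =
    trans (does-+-≤?-+ a (col y) (col z)) (sym (does-+-≤?-+ b (col y) (col z)))

  ≤ᶜ-agree : ∀ {s t} → Below s → Below t → (untag a s ≤ᶜ untag a t) ≡ (untag b s ≤ᶜ untag b t)
  ≤ᶜ-agree {s} {t} bs bt = ≤ᶜ-cong {untag a s} {untag b s} {untag a t} {untag b t}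
                                   (val-agree bs) (val-agree bt) (col-agree bs bt)

scaledSum : {A : Set} → ℚ → List A → Lin A
scaledSum c = map (c ,_)

scale : {A : Set} → ℚ → Lin A → Lin A
scale c = map (λ (d , b) → (c *ℚ d , b))

scale-identity : ∀ {A : Set} (L : Lin A) → scale 1ℚ L ≡ L
scale-identity []            = refl
scale-identity ((d , b) ∷ L) = cong₂ _∷_ (cong (_, b) (*-identityˡ d)) (scale-identity L)

linExt-++ : ∀ {A B : Set} (g : A → Lin B) P R → linExt g (P ++ R) ≡ linExt g P ++ linExt g R
linExt-++ g = concatMap-++ _

linExt-single : ∀ {A B : Set} (g : A → Lin B) c a → linExt g ((c , a) ∷ []) ≡ scale c (g a)
linExt-single g c a = ++-identityʳ (scale c (g a))

linExt-⟦⟧ : ∀ {A B : Set} (g : A → Lin B) a → linExt g ⟦ a ⟧ ≡ g a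
linExt-⟦⟧ g a = trans (linExt-single g 1ℚ a) (scale-identity (g a))

mLin-++ : ∀ P R → mLin (P ++ R) ≡ mLin P ++ mLin R
mLin-++ = linExt-++ (λ t → ⟦ m t ⟧)

mLin-scaledSum : ∀ c S → mLin (scaledSum c S) ≡ scaledSum c (map m S)
mLin-scaledSum c []      = refl
mLin-scaledSum c (w ∷ S) = cong₂ _∷_ (cong (_, m w) (*-identityʳ c)) (mLin-scaledSum c S)

scale-wordProd : ∀ c p q → scale c (wordProd p q) ≡ scaledSum c (shuffle p (q ↑ maxcol p))
scale-wordProd c p q = begin
  scale c (scaledSum 1ℚ S)             ≡⟨ map-∘ S ⟨
  map (λ w → (c *ℚ 1ℚ , w)) S    ≡⟨ map-cong-local (All.universal (λ w → cong (_, w) (*-identityʳ c)) S) ⟩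
  scaledSum c S                        ∎
  where S = shuffle p (q ↑ maxcol p)

scaled-·-⟦⟧ : ∀ c p q → ((c , p) ∷ []) · ⟦ q ⟧ ≡ scaledSum c (shuffle p (q ↑ maxcol p))
scaled-·-⟦⟧ c p q = begin
  ((c , p) ∷ []) · ⟦ q ⟧
    ≡⟨ linExt-single (λ a → linExt (wordProd a) ⟦ q ⟧) c p ⟩
  scale c (linExt (wordProd p) ⟦ q ⟧)
    ≡⟨ cong (scale c) (linExt-⟦⟧ (wordProd p) q) ⟩
  scale c (wordProd p q)
    ≡⟨ scale-wordProd c p q ⟩
  scaledSum c (shuffle p (q ↑ maxcol p))
    ∎

⟦⟧-·-scaled : ∀ c p q → ⟦ p ⟧ · ((c , q) ∷ []) ≡ scaledSum c (shuffle p (q ↑ maxcol p))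
⟦⟧-·-scaled c p q = begin
  ⟦ p ⟧ · ((c , q) ∷ [])
    ≡⟨ linExt-⟦⟧ (λ a → linExt (wordProd a) ((c , q) ∷ [])) p ⟩
  linExt (wordProd p) ((c , q) ∷ [])
    ≡⟨ linExt-single (wordProd p) c q ⟩
  scale c (wordProd p q)
    ≡⟨ scale-wordProd c p q ⟩
  scaledSum c (shuffle p (q ↑ maxcol p))
    ∎

module _ (f : ℤ → ℚ) where

  star-scaledSum-∷ : ∀ x S → star f (scaledSum 1ℚ (map (x ∷_) S)) ≡ scaledSum (f (val x)) S
  star-scaledSum-∷ x []      = refl
  star-scaledSum-∷ x (w ∷ S) =
    cong₂ _∷_ (cong (_, w) (*-identityˡ (f (val x)))) (star-scaledSum-∷ x S)

  star-⟦∷⟧-· : ∀ x p q →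
    star f ⟦ x ∷ p ⟧ · ⟦ q ⟧ ≡ scaledSum (f (val x)) (shuffle p (q ↑ maxcol p))
  star-⟦∷⟧-· x p q =
    trans (cong (_· ⟦ q ⟧) (linExt-⟦⟧ (starWord f) (x ∷ p))) (scaled-·-⟦⟧ (f (val x)) p q)

  ⟦⟧-·-star-⟦∷⟧ : ∀ p y q →
    ⟦ p ⟧ · star f ⟦ y ∷ q ⟧ ≡ scaledSum (f (val y)) (shuffle p (q ↑ maxcol p))
  ⟦⟧-·-star-⟦∷⟧ p y q =
    trans (cong (⟦ p ⟧ ·_) (linExt-⟦⟧ (starWord f) (y ∷ q))) (⟦⟧-·-scaled (f (val y)) p q)

  star-⟦∷⟧-·-⟦∷⟧ : ∀ x p y q → let a = maxcol (x ∷ p) in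
    star f (⟦ x ∷ p ⟧ · ⟦ y ∷ q ⟧)
      ≡ scaledSum (f (val x)) (shuffle p ((y ∷ q) ↑ a))
          ++ scaledSum (f (val y)) (shuffle (x ∷ p) (q ↑ a))
  star-⟦∷⟧-·-⟦∷⟧ x p y q = begin
    star f (⟦ x ∷ p ⟧ · ⟦ y ∷ q ⟧)
      ≡⟨ cong (star f) (⟦⟧-·-scaled 1ℚ (x ∷ p) (y ∷ q)) ⟩
    star f (scaledSum 1ℚ (xS₁ ++ yS₂))
      ≡⟨ cong (star f) (map-++ (1ℚ ,_) xS₁ yS₂) ⟩
    star f (scaledSum 1ℚ xS₁ ++ scaledSum 1ℚ yS₂)
      ≡⟨ linExt-++ (starWord f) (scaledSum 1ℚ xS₁) (scaledSum 1ℚ yS₂) ⟩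
    star f (scaledSum 1ℚ xS₁) ++ star f (scaledSum 1ℚ yS₂)
      ≡⟨ cong₂ _++_ (star-scaledSum-∷ x S₁) (star-scaledSum-∷ (shiftL a y) S₂) ⟩
    scaledSum (f (val x)) S₁ ++ scaledSum (f (val y)) S₂
      ∎
    where
    a   = maxcol (x ∷ p)
    S₁  = shuffle p ((y ∷ q) ↑ a)
    S₂  = shuffle (x ∷ p) (q ↑ a)
    xS₁ = map (x ∷_) S₁
    yS₂ = map (shiftL a y ∷_) S₂

  star-Leibniz-[]ˡ : ∀ y q →
    star f (⟦ [] ⟧ · ⟦ y ∷ q ⟧) ≡ (star f ⟦ [] ⟧ · ⟦ y ∷ q ⟧) ⊕ (⟦ [] ⟧ · star f ⟦ y ∷ q ⟧)
  star-Leibniz-[]ˡ y q = begin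
    star f (⟦ [] ⟧ · ⟦ y ∷ q ⟧)
      ≡⟨ cong (star f) (⟦⟧-·-scaled 1ℚ [] (y ∷ q)) ⟩
    star f (scaledSum 1ℚ (map (shiftL 0 y ∷_) ((q ↑ 0) ∷ [])))
      ≡⟨ star-scaledSum-∷ (shiftL 0 y) ((q ↑ 0) ∷ []) ⟩
    scaledSum (f (val y)) ((q ↑ 0) ∷ [])
      ≡⟨ ⟦⟧-·-star-⟦∷⟧ [] y q ⟨
    ⟦ [] ⟧ · star f ⟦ y ∷ q ⟧
      ∎

  star-Leibniz-[]ʳ : ∀ x p →
    star f (⟦ x ∷ p ⟧ · ⟦ [] ⟧) ≡ (star f ⟦ x ∷ p ⟧ · ⟦ [] ⟧) ⊕ (⟦ x ∷ p ⟧ · star f ⟦ [] ⟧)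
  star-Leibniz-[]ʳ x p = begin
    star f (⟦ x ∷ p ⟧ · ⟦ [] ⟧)
      ≡⟨ cong (star f) (⟦⟧-·-scaled 1ℚ (x ∷ p) []) ⟩
    star f (scaledSum 1ℚ (map (x ∷_) (p ∷ [])))
      ≡⟨ star-scaledSum-∷ x (p ∷ []) ⟩
    scaledSum (f (val x)) (p ∷ [])
      ≡⟨ cong (scaledSum (f (val x))) (shuffle-identityʳ p) ⟨
    scaledSum (f (val x)) (shuffle p ([] ↑ maxcol p))
      ≡⟨ ++-identityʳ _ ⟨
    scaledSum (f (val x)) (shuffle p ([] ↑ maxcol p)) ++ []
      ≡⟨ cong (_++ []) (star-⟦∷⟧-· x p []) ⟨
    (star f ⟦ x ∷ p ⟧ · ⟦ [] ⟧) ⊕ (⟦ x ∷ p ⟧ · star f ⟦ [] ⟧)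
      ∎

  mLin-star-Leibniz-∷ : ∀ x p y q →
    mLin (star f (⟦ x ∷ p ⟧ · ⟦ y ∷ q ⟧))
      ≡ mLin ((star f ⟦ x ∷ p ⟧ · ⟦ y ∷ q ⟧) ⊕ (⟦ x ∷ p ⟧ · star f ⟦ y ∷ q ⟧))
  mLin-star-Leibniz-∷ x p y q = begin
    mLin (star f (⟦ x ∷ p ⟧ · ⟦ y ∷ q ⟧))
      ≡⟨ cong mLin (star-⟦∷⟧-·-⟦∷⟧ x p y q) ⟩
    mLin (A a ++ B)
      ≡⟨ mLin-++ (A a) B ⟩
    mLin (A a) ++ mLin B
      ≡⟨ cong (_++ mLin B) shift-invisible ⟩
    mLin (A (maxcol p)) ++ mLin B
      ≡⟨ mLin-++ (A (maxcol p)) B ⟨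
    mLin (A (maxcol p) ++ B)
      ≡⟨ cong mLin (cong₂ _++_ (star-⟦∷⟧-· x p (y ∷ q)) (⟦⟧-·-star-⟦∷⟧ (x ∷ p) y q)) ⟨
    mLin ((star f ⟦ x ∷ p ⟧ · ⟦ y ∷ q ⟧) ⊕ (⟦ x ∷ p ⟧ · star f ⟦ y ∷ q ⟧))
      ∎
    where
    a = maxcol (x ∷ p)

    A : ℕ → Q
    A b = scaledSum (f (val x)) (shuffle p ((y ∷ q) ↑ b))

    B : Q
    B = scaledSum (f (val y)) (shuffle (x ∷ p) (q ↑ a))

    shift-invisible : mLin (A a) ≡ mLin (A (maxcol p))
    shift-invisible = begin
      mLin (A a)
        ≡⟨ mLin-scaledSum (f (val x)) _ ⟩
      scaledSum (f (val x)) (map m (shuffle p ((y ∷ q) ↑ a)))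
        ≡⟨ cong (scaledSum (f (val x))) (m-shuffle-↑ p (y ∷ q) (m≤n⊔m (col x) (maxcol p)) ≤-refl) ⟩
      scaledSum (f (val x)) (map m (shuffle p ((y ∷ q) ↑ maxcol p)))
        ≡⟨ mLin-scaledSum (f (val x)) _ ⟨
      mLin (A (maxcol p))
        ∎

proposition4p16 : (f : ℤ → ℚ) (p q : Word) →
    star f (⟦ p ⟧ · ⟦ q ⟧) ≡ₘ ((star f ⟦ p ⟧ · ⟦ q ⟧) ⊕ (⟦ p ⟧ · star f ⟦ q ⟧))
proposition4p16 f []      []      u = refl
proposition4p16 f []      (y ∷ q) u = cong (λ L → coeff (mLin L) u) (star-Leibniz-[]ˡ f y q)
proposition4p16 f (x ∷ p) []      u = cong (λ L → coeff (mLin L) u) (star-Leibniz-[]ʳ f x p)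
proposition4p16 f (x ∷ p) (y ∷ q) u = cong (λ L → coeff L u) (mLin-star-Leibniz-∷ f x p y q)
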